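{- Let $\Gamma$ be a connected graph with countably infinitely many vertices such that for every vertex $\delta\in V\Gamma$ the graph $\Gamma\setminus\{\delta\}$ has at least two infinite connected components. Then $\Gamma$ is $2$-distinguishable.
   Context: Graphs are simple. $\Gamma$ is $2$-distinguishable if there is a coloring of $V\Gamma$ with at most $2$ colors such that no non-identity automorphism of $\Gamma$ preserves every color class setwise. -}

module Defs where

open import Data.Nat using (ℕ; _≤_)
open import Data.Bool using (Bool)
open import Data.Product using (Σ; ∃; _×_; _,_)
open import Data.Unit using (⊤)
open import Relation.Nullary using (¬_)
open import Relation.Binary.PropositionalEquality using (_≡_)
open import Function.Bundles using (_⤖_; _⇔_; Bijection)

-- A simple graph with countably infinitely many vertices: vertex set ℕ,
-- symmetric irreflexive adjacency relation.
record Graph : Set₁ where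
  field
    Adj   : ℕ → ℕ → Set
    sym   : ∀ {u v} → Adj u v → Adj v u
    irrefl : ∀ {u} → ¬ Adj u u
open Graph public

-- Walks inside the set of vertices satisfying P (induced subgraph on P).
data Walk (Γ : Graph) (P : ℕ → Set) : ℕ → ℕ → Set where
  here : ∀ {u} → P u → Walk Γ P u u
  step : ∀ {u v w} → P u → Adj Γ u v → Walk Γ P v w → Walk Γ P u w

Connected : Graph → Set
Connected Γ = ∀ u v → Walk Γ (λ _ → ⊤) u v

Del : ℕ → ℕ → Set
Del δ x = ¬ (x ≡ δ)

Infinite : (ℕ → Set) → Set
Infinite S = ∀ n → ∃ λ m → n ≤ m × S m

-- Γ ∖ {δ} has at least two (distinct) infinite connected components:
-- two vertices of Γ ∖ {δ} lying in different components, each component infinite.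
TwoInfiniteComponentsAfterDeleting : Graph → ℕ → Set
TwoInfiniteComponentsAfterDeleting Γ δ =
  Σ ℕ λ u → Σ ℕ λ v →
    Del δ u × Del δ v × ¬ Walk Γ (Del δ) u v
    × Infinite (Walk Γ (Del δ) u) × Infinite (Walk Γ (Del δ) v)

record Automorphism (Γ : Graph) : Set where
  field
    perm : ℕ ⤖ ℕ
    adj  : ∀ u v → Adj Γ u v ⇔ Adj Γ (Bijection.to perm u) (Bijection.to perm v)
open Automorphism public

Distinguishing : (Γ : Graph) → (ℕ → Bool) → Set
Distinguishing Γ c = (φ : Automorphism Γ) →
  (∀ v → c (Bijection.to (perm φ) v) ≡ c v) → ∀ v → Bijection.to (perm φ) v ≡ v

TwoDistinguishable : Graph → Set
TwoDistinguishable Γ = Σ (ℕ → Bool) λ c → Distinguishing Γ c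

module Submission where

-- Root Γ at 0 and say that z lies beyond y when every walk from the root to z passes
-- through y. As every vertex y is a cut vertex, some component of Γ ∖ y misses the root, so
-- there are vertices beyond y at every distance exceeding that of y (only this is used of the
-- hypothesis, not the infinitude of the components). Colour black the root, two non-adjacent
-- neighbours of it, and for each vertex y one marker beyond y, the markers lying at distances
-- ≥ 3 that are pairwise at least 2 apart. A colour-preserving automorphism φ fixes the root,
-- the only black vertex with two black neighbours, hence preserves distances and the relation
-- beyond, and fixes every marker, the only black vertex at its distance. So the marker of x
-- lies beyond both x and φ x, which are at equal distance; but distinct vertices at equal
-- distance have nothing beyond them in common.


open import Defs hiding (sym)
open import Level using (0ℓ)
open import Axiom.ExcludedMiddle using (ExcludedMiddle)
open import Data.Nat using (ℕ; zero; suc; _+_; _≤_; _<_; z≤n; s≤s; _≟_)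
open import Data.Nat.Properties
  using (≤-refl; ≤-trans; ≤-antisym; ≤-reflexive; ≤⇒≯; <⇒≱; ≮⇒≥; 1+n≰n; n≤1+n; n≤0⇒n≡0;
         m≤m+n; m≤n+m; +-monoˡ-≤; <-cmp; m<1+n⇒m<n∨m≡n; m≤n⇒m<n∨m≡n)
open import Data.Nat.Induction using (<-rec)
open import Data.Bool using (Bool; T)
open import Data.Product using (Σ; ∃-syntax; _×_; _,_; proj₁; proj₂)
open import Data.Sum using (_⊎_; inj₁; inj₂)
open import Data.Empty using (⊥-elim)
open import Relation.Nullary using (¬_; yes; no; contradiction)
open import Relation.Nullary.Decidable using (isYes; toWitness; fromWitness; decidable-stable)
open import Relation.Unary using (_∩_; _⊆_)
open import Relation.Binary using (_Preserves_⟶_; tri<; tri≈; tri>)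
open import Relation.Binary.PropositionalEquality using (_≡_; _≢_; refl; sym; trans; cong; subst; subst₂)
open import Function.Base using (_∘_)
open import Function.Bundles using (Inverse; Equivalence)
open import Function.Properties.Bijection using (⤖⇒↔)

least-witness : ExcludedMiddle 0ℓ → (P : ℕ → Set) → ∀ {k} → P k →
  ∃[ m ] P m × (∀ {j} → P j → m ≤ j)
least-witness em P {k} = <-rec (λ k → P k → ∃[ m ] P m × (∀ {j} → P j → m ≤ j)) least k
  where
  least : ∀ k → (∀ {j} → j < k → P j → ∃[ m ] P m × (∀ {i} → P i → m ≤ i)) →
    P k → ∃[ m ] P m × (∀ {j} → P j → m ≤ j)
  least k below pk with em {∃[ j ] j < k × P j}
  ... | yes (j , j<k , pj) = below j<k pj
  ... | no none = k , pk , λ {j} pj → ≮⇒≥ (λ j<k → none (j , j<k , pj))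

module Spread {f : ℕ → ℕ} (gap : ∀ n → 2 + f n ≤ f (suc n)) where

  gap-< : ∀ {m n} → m < n → 2 + f m ≤ f n
  gap-< {m} {suc n} m<1+n with m<1+n⇒m<n∨m≡n m<1+n
  ... | inj₂ refl = gap m
  ... | inj₁ m<n = ≤-trans (gap-< m<n) (≤-trans (m≤n+m (f n) 2) (gap n))

  close⇒≡ : ∀ {m n} → f m ≤ suc (f n) → f n ≤ suc (f m) → m ≡ n
  close⇒≡ {m} {n} fm≤ fn≤ with <-cmp m n
  ... | tri< m<n _ _ = contradiction (≤-trans (gap-< m<n) fn≤) 1+n≰n
  ... | tri≈ _ m≡n _ = m≡n
  ... | tri> _ _ n<m = contradiction (≤-trans (gap-< n<m) fm≤) 1+n≰n

data LWalk (Γ : Graph) : ℕ → ℕ → ℕ → Set where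
  []  : ∀ {u} → LWalk Γ 0 u u
  _∷_ : ∀ {n u v w} → Adj Γ u v → LWalk Γ n v w → LWalk Γ (suc n) u w

CutVertex : Graph → ℕ → Set
CutVertex Γ δ = Σ ℕ λ u → Σ ℕ λ v → Del δ u × Del δ v × ¬ Walk Γ (Del δ) u v

cut-vertex : ∀ {Γ δ} → TwoInfiniteComponentsAfterDeleting Γ δ → CutVertex Γ δ
cut-vertex (u , v , u≢δ , v≢δ , u↮v , _) = u , v , u≢δ , v≢δ , u↮v

module Walks (Γ : Graph) where

  weaken : ∀ {P Q s t} → P ⊆ Q → Walk Γ P s t → Walk Γ Q s t
  weaken P⊆Q (here p)     = here (P⊆Q p)
  weaken P⊆Q (step p e w) = step (P⊆Q p) e (weaken P⊆Q w)

  end : ∀ {P s t} → Walk Γ P s t → P t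
  end (here p)     = p
  end (step _ _ w) = end w

  start : ∀ {P s t} → Walk Γ P s t → P s
  start (here p)     = p
  start (step p _ _) = p

  _++_ : ∀ {P s t u} → Walk Γ P s t → Walk Γ P t u → Walk Γ P s u
  here _     ++ w′ = w′
  step p e w ++ w′ = step p e (w ++ w′)

  reverse : ∀ {P s t} → Walk Γ P s t → Walk Γ P t s
  reverse (here p)     = here p
  reverse (step p e w) = reverse w ++ step (start w) (Graph.sym Γ e) (here p)

  first-hit : ∀ {P s t} y → Walk Γ P s t → s ≢ y →
    Walk Γ (P ∩ Del y) s t ⊎ ∃[ p ] Adj Γ p y × Walk Γ (P ∩ Del y) s p
  first-hit y (here p) s≢y = inj₁ (here (p , s≢y))
  first-hit y (step {u} {v} p e w) u≢y with v ≟ y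
  ... | yes refl = inj₂ (u , e , here (p , u≢y))
  ... | no v≢y with first-hit y w v≢y
  ...   | inj₁ w′            = inj₁ (step (p , u≢y) e w′)
  ...   | inj₂ (q , e′ , w′) = inj₂ (q , e′ , step (p , u≢y) e w′)

  last-before : ∀ {P s y} → Walk Γ P s y → s ≢ y → ∃[ p ] Adj Γ p y × Walk Γ (P ∩ Del y) s p
  last-before {y = y} w s≢y with first-hit y w s≢y
  ... | inj₁ w′ = contradiction refl (proj₂ (end w′))
  ... | inj₂ hit = hit

  cut-vertex⇒fork : Connected Γ → ∀ {δ} → CutVertex Γ δ →
    ∃[ a ] ∃[ b ] Adj Γ δ a × Adj Γ δ b × a ≢ b × ¬ Adj Γ a b
  cut-vertex⇒fork conn {δ} (u , v , u≢δ , v≢δ , u↮v)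
    with last-before (conn u δ) u≢δ | last-before (conn v δ) v≢δ
  ... | a , a~δ , u⇝a | b , b~δ , v⇝b =
    a , b , Graph.sym Γ a~δ , Graph.sym Γ b~δ , a≢b , a≁b
    where
    a≢b : a ≢ b
    a≢b refl = u↮v (weaken proj₂ u⇝a ++ reverse (weaken proj₂ v⇝b))
    a≁b : ¬ Adj Γ a b
    a≁b a~b = u↮v (weaken proj₂ u⇝a ++ step (proj₂ (end u⇝a)) a~b (reverse (weaken proj₂ v⇝b)))

  map-walk : ∀ {f P Q s t} → f Preserves Adj Γ ⟶ Adj Γ → (∀ {x} → P x → Q (f x)) →
    Walk Γ P s t → Walk Γ Q (f s) (f t)
  map-walk f-adj P⇒Q (here p)     = here (P⇒Q p)
  map-walk f-adj P⇒Q (step p e w) = step (P⇒Q p) (f-adj e) (map-walk f-adj P⇒Q w)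

  _∷ʳ_ : ∀ {n s t u} → LWalk Γ n s t → Adj Γ t u → LWalk Γ (suc n) s u
  []      ∷ʳ e′ = e′ ∷ []
  (e ∷ w) ∷ʳ e′ = e ∷ (w ∷ʳ e′)

  lwalk : ∀ {P s t} → Walk Γ P s t → ∃[ n ] LWalk Γ n s t
  lwalk (here _)     = 0 , []
  lwalk (step _ e w) = let n , l = lwalk w in suc n , e ∷ l

  avoids-or-visits : ∀ {n s t} y → LWalk Γ n s t → t ≢ y →
    Walk Γ (Del y) s t ⊎ ∃[ m ] m < n × LWalk Γ m s y
  avoids-or-visits y [] t≢y = inj₁ (here t≢y)
  avoids-or-visits y (_∷_ {u = s} e w) t≢y with s ≟ y
  ... | yes refl = inj₂ (0 , s≤s z≤n , [])
  ... | no s≢y with avoids-or-visits y w t≢y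
  ...   | inj₁ w′            = inj₁ (step s≢y e w′)
  ...   | inj₂ (m , m<n , w′) = inj₂ (suc m , s≤s m<n , e ∷ w′)

  map-lwalk : ∀ {f n s t} → f Preserves Adj Γ ⟶ Adj Γ → LWalk Γ n s t → LWalk Γ n (f s) (f t)
  map-lwalk f-adj []      = []
  map-lwalk f-adj (e ∷ w) = f-adj e ∷ map-lwalk f-adj w

module Aut {Γ : Graph} (φ : Automorphism Γ) where

  open Inverse (⤖⇒↔ (perm φ)) public using (to; from; strictlyInverseˡ; strictlyInverseʳ)

  to-injective : ∀ {x y} → to x ≡ to y → x ≡ y
  to-injective {x} {y} e = trans (sym (strictlyInverseʳ x)) (trans (cong from e) (strictlyInverseʳ y))

  to-adj : to Preserves Adj Γ ⟶ Adj Γ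
  to-adj {u} {v} = Equivalence.to (adj φ u v)

  from-adj : from Preserves Adj Γ ⟶ Adj Γ
  from-adj {u} {v} e = Equivalence.from (adj φ (from u) (from v))
    (subst₂ (Adj Γ) (sym (strictlyInverseˡ u)) (sym (strictlyInverseˡ v)) e)

module Rooted (em : ExcludedMiddle 0ℓ) {Γ : Graph} (conn : Connected Γ) (r : ℕ) where

  open Walks Γ

  private
    shortest : ∀ x → ∃[ n ] LWalk Γ n r x × (∀ {j} → LWalk Γ j r x → n ≤ j)
    shortest x = least-witness em (λ n → LWalk Γ n r x) (proj₂ (lwalk (conn r x)))

  dist : ℕ → ℕ
  dist x = proj₁ (shortest x)

  dist-walk : ∀ x → LWalk Γ (dist x) r x
  dist-walk x = proj₁ (proj₂ (shortest x))

  dist-minimal : ∀ {x n} → LWalk Γ n r x → dist x ≤ n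
  dist-minimal {x} = proj₂ (proj₂ (shortest x))

  dist-root : dist r ≡ 0
  dist-root = n≤0⇒n≡0 (dist-minimal [])

  dist-adj : ∀ {u v} → Adj Γ u v → dist v ≤ suc (dist u)
  dist-adj {u} e = dist-minimal (dist-walk u ∷ʳ e)

  dist-endo : ∀ {f} → f Preserves Adj Γ ⟶ Adj Γ → f r ≡ r → ∀ x → dist (f x) ≤ dist x
  dist-endo f-adj fr x =
    dist-minimal (subst (λ s → LWalk Γ _ s _) fr (map-lwalk f-adj (dist-walk x)))

  Beyond : ℕ → ℕ → Set
  Beyond y z = z ≢ y × ¬ Walk Γ (Del y) r z

  beyond-deeper : ∀ {y z} → Beyond y z → dist y < dist z
  beyond-deeper {y} {z} (z≢y , r↛z) with avoids-or-visits y (dist-walk z) z≢y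
  ... | inj₁ w = contradiction w r↛z
  ... | inj₂ (m , m<dz , w) = ≤-trans (s≤s (dist-minimal w)) m<dz

  root∉beyond : ∀ {y z} → Beyond y z → r ≢ z
  root∉beyond (r≢y , r↛r) refl = r↛r (here r≢y)

  reach-avoiding : ∀ {y z} → z ≢ y → dist z ≤ dist y → Walk Γ (Del y) r z
  reach-avoiding {y} {z} z≢y dz≤dy with em {Walk Γ (Del y) r z}
  ... | yes w = w
  ... | no r↛z = contradiction dz≤dy (<⇒≱ (beyond-deeper (z≢y , r↛z)))

  beyond-trans : ∀ {y z t} → Beyond y z → Beyond z t → Beyond y t
  beyond-trans {y} {z} {t} y⊲z@(z≢y , r↛z) z⊲t@(_ , r↛t) = t≢y , r↛t-avoiding-y
    where
    t≢y : t ≢ y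
    t≢y refl = <⇒≱ (beyond-deeper y⊲z) (≤-trans (n≤1+n _) (beyond-deeper z⊲t))
    r↛t-avoiding-y : ¬ Walk Γ (Del y) r t
    r↛t-avoiding-y w with first-hit z w (root∉beyond y⊲z)
    ... | inj₁ w′ = r↛t (weaken proj₂ w′)
    ... | inj₂ (p , p~z , w′) = r↛z (weaken proj₁ w′ ++ step (proj₁ (end w′)) p~z (here z≢y))

  -- Walk from z towards y up to the last vertex q before y. If that walk avoids x, then
  -- r ⇝ y ~ q ⇝ z avoids x, since y, being no deeper than x, is not beyond x; otherwise
  -- its first visit to x gives r ⇝ x ~ p ⇝ z avoiding y.
  beyond-disjoint : ∀ {x y z} → dist x ≡ dist y → Beyond x z → Beyond y z → x ≡ y
  beyond-disjoint {x} {y} {z} dx≡dy (z≢x , r↛z-x) (z≢y , r↛z-y) =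
    decidable-stable (x ≟ y) x≢y-absurd
    where
    x≢y-absurd : ¬ x ≢ y
    x≢y-absurd x≢y with last-before (conn z y) z≢y
    ... | q , q~y , z⇝q with first-hit x z⇝q z≢x
    ...   | inj₁ w = r↛z-x (reach-avoiding (x≢y ∘ sym) (≤-reflexive (sym dx≡dy))
                         ++ step (x≢y ∘ sym) (Graph.sym Γ q~y) (reverse (weaken proj₂ w)))
    ...   | inj₂ (p , p~x , w) = r↛z-y (reach-avoiding x≢y (≤-reflexive dx≡dy)
                         ++ step x≢y (Graph.sym Γ p~x) (reverse (weaken (proj₂ ∘ proj₁) w)))

  beyond-neighbour : ∀ {y w} → Beyond y w → ∃[ z ] Adj Γ y z × Beyond y z
  beyond-neighbour {y} {w} (w≢y , r↛w) with last-before (conn w y) w≢y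
  ... | p , p~y , w⇝p =
    p , Graph.sym Γ p~y , proj₂ (end w⇝p) , λ r⇝p → r↛w (r⇝p ++ reverse (weaken proj₂ w⇝p))

  beyond-neighbour-dist : ∀ {y z} → Adj Γ y z → Beyond y z → dist z ≡ suc (dist y)
  beyond-neighbour-dist y~z y⊲z = ≤-antisym (dist-adj y~z) (beyond-deeper y⊲z)

  module Preserved (φ : Automorphism Γ) (fixes-root : Aut.to φ r ≡ r) where

    open Aut φ

    from-root : from r ≡ r
    from-root = trans (cong from (sym fixes-root)) (strictlyInverseʳ r)

    dist-preserved : ∀ x → dist (to x) ≡ dist x
    dist-preserved x = ≤-antisym (dist-endo to-adj fixes-root x)
      (subst (λ v → dist v ≤ dist (to x)) (strictlyInverseʳ x) (dist-endo from-adj from-root (to x)))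

    beyond-preserved : ∀ {x z} → Beyond x z → Beyond (to x) (to z)
    beyond-preserved {x} {z} (z≢x , r↛z) = (λ e → z≢x (to-injective e)) , λ w →
      r↛z (subst₂ (Walk Γ (Del x)) from-root (strictlyInverseʳ z) (map-walk from-adj avoid w))
      where
      avoid : ∀ {v} → v ≢ to x → from v ≢ x
      avoid {v} v≢tx e = v≢tx (trans (sym (strictlyInverseˡ v)) (cong to e))

module AllCutVertices (em : ExcludedMiddle 0ℓ) {Γ : Graph} (conn : Connected Γ)
                      (cut : ∀ δ → CutVertex Γ δ) (r : ℕ) where

  open Walks Γ
  open Rooted em conn r

  beyond-nonempty : ∀ y → ∃[ z ] Beyond y z
  beyond-nonempty y with cut y
  ... | u , v , u≢y , v≢y , u↮v with em {Walk Γ (Del y) r u} | em {Walk Γ (Del y) r v}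
  ...   | no r↛u | _      = u , u≢y , r↛u
  ...   | yes _  | no r↛v = v , v≢y , r↛v
  ...   | yes r⇝u | yes r⇝v = ⊥-elim (u↮v (reverse r⇝u ++ r⇝v))

  beyond-at-dist : ∀ y {n} → dist y < n → ∃[ z ] Beyond y z × dist z ≡ n
  beyond-at-dist y {suc n} (s≤s dy≤n) with m≤n⇒m<n∨m≡n dy≤n
  ... | inj₂ refl =
    let z , y~z , y⊲z = beyond-neighbour (proj₂ (beyond-nonempty y))
    in z , y⊲z , beyond-neighbour-dist y~z y⊲z
  ... | inj₁ dy<n =
    let z , y⊲z , dz≡n = beyond-at-dist y dy<n
        t , z~t , z⊲t = beyond-neighbour (proj₂ (beyond-nonempty z))
    in t , beyond-trans y⊲z z⊲t , trans (beyond-neighbour-dist z~t z⊲t) (cong suc dz≡n)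

module Colouring (em : ExcludedMiddle 0ℓ) {Γ : Graph} (conn : Connected Γ)
                 (cut : ∀ δ → CutVertex Γ δ) where

  open Walks Γ

  root : ℕ
  root = 0

  open Rooted em conn root
  open AllCutVertices em conn cut root

  depth : ℕ → ℕ
  depth zero    = 3 + dist zero
  depth (suc n) = 3 + dist (suc n) + depth n

  depth-gap : ∀ n → 2 + depth n ≤ depth (suc n)
  depth-gap n = +-monoˡ-≤ (depth n) (s≤s (s≤s z≤n))

  open Spread depth-gap

  depth-deep : ∀ y → 3 + dist y ≤ depth y
  depth-deep zero    = ≤-refl
  depth-deep (suc n) = m≤m+n (3 + dist (suc n)) (depth n)

  private
    marker-spec : ∀ y → ∃[ z ] Beyond y z × dist z ≡ depth y
    marker-spec y = beyond-at-dist y (≤-trans (m≤n+m (suc (dist y)) 2) (depth-deep y))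

  marker : ℕ → ℕ
  marker y = proj₁ (marker-spec y)

  beyond-marker : ∀ y → Beyond y (marker y)
  beyond-marker y = proj₁ (proj₂ (marker-spec y))

  dist-marker : ∀ y → dist (marker y) ≡ depth y
  dist-marker y = proj₂ (proj₂ (marker-spec y))

  marker-far : ∀ y → 3 ≤ dist (marker y)
  marker-far y = subst (3 ≤_) (sym (dist-marker y)) (≤-trans (m≤m+n 3 (dist y)) (depth-deep y))

  fork : ∃[ a ] ∃[ b ] Adj Γ root a × Adj Γ root b × a ≢ b × ¬ Adj Γ a b
  fork = cut-vertex⇒fork conn (cut root)

  a b : ℕ
  a = proj₁ fork
  b = proj₁ (proj₂ fork)

  root~a : Adj Γ root a
  root~a = proj₁ (proj₂ (proj₂ fork))

  root~b : Adj Γ root b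
  root~b = proj₁ (proj₂ (proj₂ (proj₂ fork)))

  a≢b : a ≢ b
  a≢b = proj₁ (proj₂ (proj₂ (proj₂ (proj₂ fork))))

  a≁b : ¬ Adj Γ a b
  a≁b = proj₂ (proj₂ (proj₂ (proj₂ (proj₂ fork))))

  Leaf : ℕ → Set
  Leaf v = v ≡ a ⊎ v ≡ b

  Anchor : ℕ → Set
  Anchor v = v ≡ root ⊎ Leaf v

  Black : ℕ → Set
  Black v = Anchor v ⊎ ∃[ y ] v ≡ marker y

  colour : ℕ → Bool
  colour v = isYes (em {Black v})

  anchor-near : ∀ {v} → Anchor v → dist v ≤ 1
  anchor-near (inj₁ refl)        = subst (_≤ 1) (sym dist-root) z≤n
  anchor-near (inj₂ (inj₁ refl)) = subst (λ d → dist a ≤ suc d) dist-root (dist-adj root~a)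
  anchor-near (inj₂ (inj₂ refl)) = subst (λ d → dist b ≤ suc d) dist-root (dist-adj root~b)

  marker-isolated : ∀ {y p} → Black p → ¬ Adj Γ (marker y) p
  marker-isolated {y} (inj₁ p-anchor) m~p =
    ≤⇒≯ (marker-far y) (s≤s (≤-trans (dist-adj (Graph.sym Γ m~p)) (s≤s (anchor-near p-anchor))))
  marker-isolated {y} (inj₂ (y′ , refl)) m~p
    with close⇒≡ {y} {y′} (subst₂ (λ d d′ → d ≤ suc d′) (dist-marker y) (dist-marker y′) (dist-adj (Graph.sym Γ m~p)))
                          (subst₂ (λ d d′ → d ≤ suc d′) (dist-marker y′) (dist-marker y) (dist-adj m~p))
  ... | refl = Graph.irrefl Γ m~p

  leaf-black-neighbour : ∀ {w p} → Leaf w → Black p → Adj Γ w p → p ≡ root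
  leaf-black-neighbour _           (inj₁ (inj₁ p≡root))    _   = p≡root
  leaf-black-neighbour (inj₁ refl) (inj₁ (inj₂ (inj₁ refl))) a~a = ⊥-elim (Graph.irrefl Γ a~a)
  leaf-black-neighbour (inj₁ refl) (inj₁ (inj₂ (inj₂ refl))) a~b = ⊥-elim (a≁b a~b)
  leaf-black-neighbour (inj₂ refl) (inj₁ (inj₂ (inj₁ refl))) b~a = ⊥-elim (a≁b (Graph.sym Γ b~a))
  leaf-black-neighbour (inj₂ refl) (inj₁ (inj₂ (inj₂ refl))) b~b = ⊥-elim (Graph.irrefl Γ b~b)
  leaf-black-neighbour w-leaf      (inj₂ (y , refl))         w~m =
    ⊥-elim (marker-isolated {y} (inj₁ (inj₂ w-leaf)) (Graph.sym Γ w~m))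

  two-black-neighbours⇒root : ∀ {w p q} → Black w → Black p → Black q →
    Adj Γ w p → Adj Γ w q → p ≢ q → w ≡ root
  two-black-neighbours⇒root (inj₁ (inj₁ w≡root)) _ _ _ _ _ = w≡root
  two-black-neighbours⇒root (inj₁ (inj₂ w-leaf)) p-black q-black w~p w~q p≢q =
    contradiction (trans (leaf-black-neighbour w-leaf p-black w~p)
                         (sym (leaf-black-neighbour w-leaf q-black w~q))) p≢q
  two-black-neighbours⇒root (inj₂ (y , refl)) p-black _ w~p _ _ =
    ⊥-elim (marker-isolated {y} p-black w~p)

  black-at-depth : ∀ {v x} → Black v → dist v ≡ depth x → v ≡ marker x
  black-at-depth {v} {x} (inj₁ v-anchor) dv≡ =
    ⊥-elim (≤⇒≯ (marker-far x) (s≤s (≤-trans (≤-reflexive (trans (dist-marker x) (sym dv≡)))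
                                           (≤-trans (anchor-near v-anchor) (n≤1+n 1)))))
  black-at-depth {x = x} (inj₂ (y , refl)) dm≡ with close⇒≡ {y} {x}
    (≤-trans (≤-reflexive (trans (sym (dist-marker y)) dm≡)) (n≤1+n _))
    (≤-trans (≤-reflexive (trans (sym dm≡) (dist-marker y))) (n≤1+n _))
  ... | refl = refl

  distinguishing : Distinguishing Γ colour
  distinguishing φ keeps v = beyond-disjoint (dist-preserved v) to-v⊲marker (beyond-marker v)
    where
    open Aut φ

    black-preserved : ∀ {u} → Black u → Black (to u)
    black-preserved {u} u-black =
      toWitness {a? = em} (subst T (sym (keeps u)) (fromWitness {a? = em} u-black))

    fixes-root : to root ≡ root
    fixes-root = two-black-neighbours⇒root
      (black-preserved (inj₁ (inj₁ refl))) (black-preserved (inj₁ (inj₂ (inj₁ refl))))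
      (black-preserved (inj₁ (inj₂ (inj₂ refl)))) (to-adj root~a) (to-adj root~b) (λ e → a≢b (to-injective e))

    open Preserved φ fixes-root

    fixes-marker : to (marker v) ≡ marker v
    fixes-marker = black-at-depth {x = v} (black-preserved (inj₂ (v , refl)))
      (trans (dist-preserved (marker v)) (dist-marker v))

    to-v⊲marker : Beyond (to v) (marker v)
    to-v⊲marker = subst (Beyond (to v)) fixes-marker (beyond-preserved (beyond-marker v))

theorem8 : ExcludedMiddle 0ℓ → (Γ : Graph) → Connected Γ →
    (∀ δ → TwoInfiniteComponentsAfterDeleting Γ δ) → TwoDistinguishable Γ
theorem8 em Γ conn two-components = colour , distinguishing
  where open Colouring em conn (λ δ → cut-vertex (two-components δ))
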